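{- Let $c \geq 2$ and $s \geq 2$ be integers. If $t \leq \lfloor \log_c (s-1) \rfloor$ or $t \geq c^s - \lfloor \log_c (s-1) \rfloor$, then the complete bipartite graph $K_{s,t}$ does not have an identity $c$-edge coloring.
   Context: A $c$-edge coloring assigns to each edge one of $c$ colors. A (color-preserving) automorphism of an edge-colored graph is a graph automorphism $\phi$ such that each edge $uv$ has the same color as the edge $\phi(u)\phi(v)$. An identity $c$-edge coloring is a $c$-edge coloring whose only color-preserving automorphism is the identity. -}

module Defs where

open import Data.Nat using (ℕ; suc; _≤_; _<_; _^_)
open import Data.Fin using (Fin)
open import Data.Sum using (_⊎_; inj₁; inj₂)
open import Data.Product using (_×_)
open import Function.Bundles using (Inverse; Equivalence; _↔_; _⇔_)
open import Relation.Binary.PropositionalEquality using (_≡_)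

-- ⌊log_c n⌋ = k, specified as the (unique, for c ≥ 2 and n ≥ 1) k with c^k ≤ n < c^(k+1)
IsFloorLog : (c n k : ℕ) → Set
IsFloorLog c n k = (c ^ k ≤ n) × (n < c ^ suc k)

V : ℕ → ℕ → Set
V s t = Fin s ⊎ Fin t

data Adj {s t : ℕ} : V s t → V s t → Set where
  adj₁₂ : (i : Fin s) (j : Fin t) → Adj (inj₁ i) (inj₂ j)
  adj₂₁ : (j : Fin t) (i : Fin s) → Adj (inj₂ j) (inj₁ i)

EdgeColouring : ℕ → ℕ → ℕ → Set
EdgeColouring c s t = Fin s → Fin t → Fin c

edgeColour : ∀ {c s t} → EdgeColouring c s t → (u v : V s t) → Adj u v → Fin c
edgeColour χ .(inj₁ i) .(inj₂ j) (adj₁₂ i j) = χ i j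
edgeColour χ .(inj₂ j) .(inj₁ i) (adj₂₁ j i) = χ i j

record Automorphism (s t : ℕ) : Set where
  field
    perm     : V s t ↔ V s t
    preserve : ∀ u v → Adj u v ⇔ Adj (Inverse.to perm u) (Inverse.to perm v)

ColourPreserving : ∀ {c s t} → EdgeColouring c s t → Automorphism s t → Set
ColourPreserving χ φ =
  ∀ u v (a : Adj u v) →
    edgeColour χ u v a ≡
    edgeColour χ (Inverse.to perm u) (Inverse.to perm v) (Equivalence.to (preserve u v) a)
  where open Automorphism φ

IsIdentityColouring : ∀ {c s t} → EdgeColouring c s t → Set
IsIdentityColouring {s = s} {t = t} χ =
  (φ : Automorphism s t) → ColourPreserving χ φ →
    ∀ v → Inverse.to (Automorphism.perm φ) v ≡ v

-- Two vertices of the same side with identical colour vectors ("twins") can be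
-- swapped, so an identity colouring has pairwise distinct rows and pairwise
-- distinct columns.  If t ≤ k there are only c ^ t ≤ c ^ k ≤ s - 1 possible rows.
-- If t ≥ c ^ s - k and the columns are distinct, at most k of the c ^ s colour
-- vectors of length s are missing as columns; the s rows restricted to these
-- missing positions take at most c ^ k < s values, so two vertices a ≠ b agree on
-- every missing vector.  Transposing a and b then maps columns to columns, since a
-- column mapped to a missing vector would be fixed by the transposition; together
-- with the induced permutation of the t-side this is a nontrivial colour-preserving
-- automorphism.

module Submission where

open import Defs
open import Data.Nat
  using (ℕ; zero; suc; _+_; _∸_; _^_; _≤_; _≥_; _<_; NonZero; >-nonZero; s≤s; z≤n)
open import Data.Nat.Properties
  using ( +-comm; +-cancelʳ-≤; +-monoʳ-≤; m≤n+m∸n; ≤-trans; ≤-<-trans; <-≤-trans; ^-monoʳ-≤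
        ; module ≤-Reasoning)
open import Data.Fin using (Fin; zero; suc; combine; funToFin; finToFun; splitAt; _≟_)
open import Data.Fin.Properties
  using (finToFun-funToFin; pigeonhole; injective⇒≤; any?; <⇒≢; +↔⊎)
open import Data.Fin.Permutation.Components using (transpose)
open import Data.Sum using (_⊎_; inj₁; inj₂; [_,_]; [_,_]′)
open import Data.Sum.Properties using (inj₁-injective; inj₂-injective)
open import Data.Product using (∃; ∃₂; _×_; _,_; proj₁; proj₂)
open import Data.List using (List; _∷_; length; filter; allFin; lookup)
import Data.List.Relation.Unary.All as All
open import Data.List.Relation.Unary.Any using (index)
open import Data.List.Relation.Unary.Any.Properties using (lookup-index)
open import Data.List.Membership.Propositional using (_∈_)
open import Data.List.Membership.Propositional.Properties
  using (∈-lookup; ∈-filter⁺; ∈-filter⁻; ∈-allFin)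
open import Data.List.Relation.Unary.Unique.Propositional using (Unique)
open import Data.List.Relation.Unary.Unique.Propositional.Properties using (filter⁺; allFin⁺)
open import Data.List.Relation.Unary.AllPairs using (_∷_)
open import Algebra.Definitions using (Involutive)
open import Function using (_∘_)
open import Function.Bundles using (Injection; mk↔ₛ′; mk⇔)
open import Function.Definitions using (Injective)
open import Function.Properties.Inverse using (↔⇒↣)
open import Relation.Binary.PropositionalEquality hiding ([_])
open import Relation.Nullary using (¬_; yes; no; ¬?; contradiction)
open import Relation.Nullary.Decidable using (_×-dec_; decidable-stable)
open import Relation.Unary using (Pred; Decidable)
open import Level using (0ℓ)

module _ {n : ℕ} (i j : Fin n) where

  transpose-moves : transpose i j i ≡ j
  transpose-moves with i ≟ i
  ... | yes _   = refl
  ... | no i≢i = contradiction refl i≢i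

  transpose-moves′ : transpose i j j ≡ i
  transpose-moves′ with j ≟ i
  ... | yes j≡i = j≡i
  ... | no _ with j ≟ j
  ...   | yes _   = refl
  ...   | no j≢j = contradiction refl j≢j

  transpose-fixes : ∀ {k} → k ≢ i → k ≢ j → transpose i j k ≡ k
  transpose-fixes {k} k≢i k≢j with k ≟ i
  ... | yes k≡i = contradiction k≡i k≢i
  ... | no _ with k ≟ j
  ...   | yes k≡j = contradiction k≡j k≢j
  ...   | no _    = refl

  transpose-fixesˡ⇒≡ : transpose i j i ≡ i → i ≡ j
  transpose-fixesˡ⇒≡ fixed = trans (sym fixed) transpose-moves

  transpose-involutive : Involutive _≡_ (transpose i j)
  transpose-involutive k with k ≟ i
  ... | yes refl = transpose-moves′
  ... | no k≢i with k ≟ j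
  ...   | yes refl = transpose-moves
  ...   | no k≢j   = transpose-fixes k≢i k≢j

  transpose-invariant : ∀ {A : Set} (f : Fin n → A) → f i ≡ f j →
                        ∀ k → f (transpose i j k) ≡ f k
  transpose-invariant f fi≡fj k with k ≟ i
  ... | yes refl = sym fi≡fj
  ... | no _ with k ≟ j
  ...   | yes refl = fi≡fj
  ...   | no _     = refl

funToFin-cong : ∀ {m n} {f g : Fin m → Fin n} → (∀ i → f i ≡ g i) → funToFin f ≡ funToFin g
funToFin-cong {zero}  f≗g = refl
funToFin-cong {suc m} f≗g = cong₂ combine (f≗g zero) (funToFin-cong (f≗g ∘ suc))

funToFin-injective : ∀ {m n} {f g : Fin m → Fin n} → funToFin f ≡ funToFin g → ∀ i → f i ≡ g i
funToFin-injective {f = f} {g} eq i = begin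
  f i                      ≡⟨ finToFun-funToFin f i ⟨
  finToFun (funToFin f) i  ≡⟨ cong (λ w → finToFun w i) eq ⟩
  finToFun (funToFin g) i  ≡⟨ finToFun-funToFin g i ⟩
  g i                      ∎
  where open ≡-Reasoning

injective⊎collision : ∀ {m n} (f : Fin m → Fin n) →
  Injective _≡_ _≡_ f ⊎ ∃₂ λ i j → i ≢ j × f i ≡ f j
injective⊎collision f with any? (λ i → any? (λ j → ¬? (i ≟ j) ×-dec (f i ≟ f j)))
... | yes (i , j , collision) = inj₂ (i , j , collision)
... | no noCollision = inj₁ injective
  where
  injective : Injective _≡_ _≡_ f
  injective {i} {j} fi≡fj with i ≟ j
  ... | yes i≡j = i≡j
  ... | no i≢j  = contradiction (i , j , i≢j , fi≡fj) noCollision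

disjoint-injections⇒+≤ : ∀ {m n o} {f : Fin m → Fin o} {g : Fin n → Fin o} →
  Injective _≡_ _≡_ f → Injective _≡_ _≡_ g → (∀ x y → f x ≢ g y) → m + n ≤ o
disjoint-injections⇒+≤ {m} {n} {f = f} {g} f-inj g-inj disjoint =
  injective⇒≤ (splitAt-injective ∘ [f,g]-injective)
  where
  splitAt-injective : Injective _≡_ _≡_ (splitAt m {n})
  splitAt-injective = Injection.injective (↔⇒↣ +↔⊎)

  [f,g]-injective : Injective _≡_ _≡_ [ f , g ]
  [f,g]-injective {inj₁ x} {inj₁ y} eq = cong inj₁ (f-inj eq)
  [f,g]-injective {inj₁ x} {inj₂ y} eq = contradiction eq (disjoint x y)
  [f,g]-injective {inj₂ x} {inj₁ y} eq = contradiction (sym eq) (disjoint y x)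
  [f,g]-injective {inj₂ x} {inj₂ y} eq = cong inj₂ (g-inj eq)

lookup-injective : ∀ {A : Set} {xs : List A} → Unique xs → Injective _≡_ _≡_ (lookup xs)
lookup-injective {xs = x ∷ xs} (x∉xs ∷ u) {zero}  {zero}  _  = refl
lookup-injective {xs = x ∷ xs} (x∉xs ∷ u) {zero}  {suc j} eq =
  contradiction eq (All.lookup x∉xs (∈-lookup j))
lookup-injective {xs = x ∷ xs} (x∉xs ∷ u) {suc i} {zero}  eq =
  contradiction (sym eq) (All.lookup x∉xs (∈-lookup i))
lookup-injective {xs = x ∷ xs} (x∉xs ∷ u) {suc i} {suc j} eq =
  cong suc (lookup-injective u eq)

module _ {n p} {P : Pred (Fin n) p} (P? : Decidable P) where

  private
    elements : List (Fin n)
    elements = filter P? (allFin n)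

  card : ℕ
  card = length elements

  enumerate : Fin card → Fin n
  enumerate = lookup elements

  enumerate-injective : Injective _≡_ _≡_ enumerate
  enumerate-injective = lookup-injective (filter⁺ P? (allFin⁺ n))

  enumerate-sound : ∀ m → P (enumerate m)
  enumerate-sound m = proj₂ (∈-filter⁻ P? {xs = allFin n} (∈-lookup m))

  enumerate-complete : ∀ {w} → P w → ∃ λ m → enumerate m ≡ w
  enumerate-complete {w} Pw = index w∈ , sym (lookup-index w∈)
    where
    w∈ : w ∈ elements
    w∈ = ∈-filter⁺ P? (∈-allFin w) Pw

module _ {c s t : ℕ} {χ : EdgeColouring c s t} {τ : Fin s → Fin s} {π : Fin t → Fin t}
         (τ-involutive : Involutive _≡_ τ) (π-involutive : Involutive _≡_ π)
         (χ-invariant : ∀ i j → χ (τ i) (π j) ≡ χ i j) where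

  private
    σ : V s t → V s t
    σ (inj₁ i) = inj₁ (τ i)
    σ (inj₂ j) = inj₂ (π j)

    σ-involutive : Involutive _≡_ σ
    σ-involutive (inj₁ i) = cong inj₁ (τ-involutive i)
    σ-involutive (inj₂ j) = cong inj₂ (π-involutive j)

    σ-preserves-Adj : ∀ u v → Adj u v → Adj (σ u) (σ v)
    σ-preserves-Adj _ _ (adj₁₂ i j) = adj₁₂ (τ i) (π j)
    σ-preserves-Adj _ _ (adj₂₁ j i) = adj₂₁ (π j) (τ i)

    σ-reflects-Adj : ∀ u v → Adj (σ u) (σ v) → Adj u v
    σ-reflects-Adj (inj₁ i) (inj₂ j) _ = adj₁₂ i j
    σ-reflects-Adj (inj₂ j) (inj₁ i) _ = adj₂₁ j i

  involutionAutomorphism : Automorphism s t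
  involutionAutomorphism = record
    { perm     = mk↔ₛ′ σ σ σ-involutive σ-involutive
    ; preserve = λ u v → mk⇔ (σ-preserves-Adj u v) (σ-reflects-Adj u v)
    }

  involutionAutomorphism-colourPreserving : ColourPreserving χ involutionAutomorphism
  involutionAutomorphism-colourPreserving _ _ (adj₁₂ i j) = sym (χ-invariant i j)
  involutionAutomorphism-colourPreserving _ _ (adj₂₁ j i) = sym (χ-invariant i j)

  identityColouring⇒trivialInvolutions :
    IsIdentityColouring χ → (∀ i → τ i ≡ i) × (∀ j → π j ≡ j)
  identityColouring⇒trivialInvolutions isId =
    (λ i → inj₁-injective (fixes (inj₁ i))) , (λ j → inj₂-injective (fixes (inj₂ j)))
    where
    fixes : ∀ v → σ v ≡ v
    fixes = isId involutionAutomorphism involutionAutomorphism-colourPreserving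

module _ {c s t : ℕ} {χ : EdgeColouring c s t} where

  equalRows⇒¬identity : ∀ {a b} → a ≢ b → (∀ j → χ a j ≡ χ b j) → ¬ IsIdentityColouring χ
  equalRows⇒¬identity {a} {b} a≢b rows isId = a≢b (transpose-fixesˡ⇒≡ a b (τ-trivial a))
    where
    χ-invariant : ∀ i j → χ (transpose a b i) j ≡ χ i j
    χ-invariant i j = transpose-invariant a b (λ i → χ i j) (rows j) i

    τ-trivial : ∀ i → transpose a b i ≡ i
    τ-trivial = proj₁ (identityColouring⇒trivialInvolutions
      (transpose-involutive a b) (λ _ → refl) χ-invariant isId)

  equalColumns⇒¬identity : ∀ {a b} → a ≢ b → (∀ i → χ i a ≡ χ i b) → ¬ IsIdentityColouring χ
  equalColumns⇒¬identity {a} {b} a≢b columns isId = a≢b (transpose-fixesˡ⇒≡ a b (π-trivial a))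
    where
    χ-invariant : ∀ i j → χ i (transpose a b j) ≡ χ i j
    χ-invariant i = transpose-invariant a b (χ i) (columns i)

    π-trivial : ∀ j → transpose a b j ≡ j
    π-trivial = proj₂ (identityColouring⇒trivialInvolutions
      (λ _ → refl) (transpose-involutive a b) χ-invariant isId)

module _ {c s t : ℕ} (χ : EdgeColouring c s t) where

  -- Rows and columns are encoded as codes in Fin (c ^ n) so that the pigeonhole
  -- principle and decidable equality on Fin apply to them.
  row : Fin s → Fin (c ^ t)
  row i = funToFin (χ i)

  column : Fin t → Fin (c ^ s)
  column j = funToFin (λ i → χ i j)

  c^t<s⇒¬identity : c ^ t < s → ¬ IsIdentityColouring χ
  c^t<s⇒¬identity c^t<s with pigeonhole c^t<s row
  ... | a , b , a<b , same = equalRows⇒¬identity (<⇒≢ a<b) (funToFin-injective same)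

  IsColumn : Pred (Fin (c ^ s)) 0ℓ
  IsColumn w = ∃ λ j → column j ≡ w

  isColumn? : Decidable IsColumn
  isColumn? w = any? (λ j → column j ≟ w)

  isMissing? : Decidable (¬_ ∘ IsColumn)
  isMissing? = ¬? ∘ isColumn?

  #missing : ℕ
  #missing = card isMissing?

  missing : Fin #missing → Fin (c ^ s)
  missing = enumerate isMissing?

  t+#missing≤c^s : Injective _≡_ _≡_ column → t + #missing ≤ c ^ s
  t+#missing≤c^s column-injective =
    disjoint-injections⇒+≤ column-injective (enumerate-injective isMissing?)
      (λ j m eq → enumerate-sound isMissing? m (j , eq))

  AgreeOnMissing : Fin s → Fin s → Set
  AgreeOnMissing a b = ∀ w → ¬ IsColumn w → finToFun w a ≡ finToFun w b

  c^#missing<s⇒agreeing : c ^ #missing < s → ∃₂ λ a b → a ≢ b × AgreeOnMissing a b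
  c^#missing<s⇒agreeing lt with pigeonhole lt (λ a → funToFin (λ m → finToFun (missing m) a))
  ... | a , b , a<b , same = a , b , <⇒≢ a<b , agree
    where
    agree : AgreeOnMissing a b
    agree w w∉ with enumerate-complete isMissing? w∉
    ... | m , refl = funToFin-injective same m

  module _ (column-injective : Injective _≡_ _≡_ column)
           {a b : Fin s} (agree : AgreeOnMissing a b) where

    private
      τ : Fin s → Fin s
      τ = transpose a b

      transposedColumn : Fin t → Fin (c ^ s)
      transposedColumn j = funToFin (λ i → χ (τ i) j)

      -- A missing transposed column would be fixed by the transposition, as a and b
      -- agree on it, and hence be column j itself.
      transposedColumn-isColumn : ∀ j → IsColumn (transposedColumn j)
      transposedColumn-isColumn j =
        decidable-stable (isColumn? (transposedColumn j)) λ w∉ →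
          w∉ (j , funToFin-cong (λ i → sym (transpose-invariant a b (λ i → χ i j) (χaj≡χbj w∉) i)))
        where
        χaj≡χbj : ¬ IsColumn (transposedColumn j) → χ a j ≡ χ b j
        χaj≡χbj w∉ = begin
          χ a j                                ≡⟨ cong (λ i → χ i j) (transpose-moves′ a b) ⟨
          χ (τ b) j                            ≡⟨ finToFun-funToFin (λ i → χ (τ i) j) b ⟨
          finToFun (transposedColumn j) b      ≡⟨ agree _ w∉ ⟨
          finToFun (transposedColumn j) a      ≡⟨ finToFun-funToFin (λ i → χ (τ i) j) a ⟩
          χ (τ a) j                            ≡⟨ cong (λ i → χ i j) (transpose-moves a b) ⟩
          χ b j                                ∎
          where open ≡-Reasoning

      π : Fin t → Fin t
      π j = proj₁ (transposedColumn-isColumn j)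

      χ-π : ∀ i j → χ i (π j) ≡ χ (τ i) j
      χ-π i j = funToFin-injective (proj₂ (transposedColumn-isColumn j)) i

      χ-invariant : ∀ i j → χ (τ i) (π j) ≡ χ i j
      χ-invariant i j = trans (χ-π (τ i) j) (cong (λ i → χ i j) (transpose-involutive a b i))

      π-involutive : Involutive _≡_ π
      π-involutive j =
        column-injective (funToFin-cong λ i → trans (χ-π i (π j)) (χ-invariant i j))

    agreeOnMissing⇒¬identity : a ≢ b → ¬ IsIdentityColouring χ
    agreeOnMissing⇒¬identity a≢b isId = a≢b (transpose-fixesˡ⇒≡ a b (τ-trivial a))
      where
      τ-trivial : ∀ i → τ i ≡ i
      τ-trivial = proj₁ (identityColouring⇒trivialInvolutions
        (transpose-involutive a b) π-involutive χ-invariant isId)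

  c^s∸k≤t⇒#missing≤k : ∀ {k} → Injective _≡_ _≡_ column → c ^ s ∸ k ≤ t → #missing ≤ k
  c^s∸k≤t⇒#missing≤k {k} column-injective c^s∸k≤t = +-cancelʳ-≤ t #missing k (begin
    #missing + t        ≡⟨ +-comm #missing t ⟩
    t + #missing        ≤⟨ t+#missing≤c^s column-injective ⟩
    c ^ s               ≤⟨ m≤n+m∸n (c ^ s) k ⟩
    k + (c ^ s ∸ k)     ≤⟨ +-monoʳ-≤ k c^s∸k≤t ⟩
    k + t               ∎)
    where open ≤-Reasoning

  c^s∸k≤t⇒¬identity : ∀ {k} .{{_ : NonZero c}} →
    c ^ k < s → c ^ s ∸ k ≤ t → ¬ IsIdentityColouring χ
  c^s∸k≤t⇒¬identity {k} c^k<s c^s∸k≤t with injective⊎collision column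
  ... | inj₂ (j , j′ , j≢j′ , same) = equalColumns⇒¬identity j≢j′ (funToFin-injective same)
  ... | inj₁ column-injective
    with c^#missing<s⇒agreeing
           (≤-<-trans (^-monoʳ-≤ c (c^s∸k≤t⇒#missing≤k {k} column-injective c^s∸k≤t)) c^k<s)
  ...   | a , b , a≢b , agree = agreeOnMissing⇒¬identity column-injective agree a≢b

lemma4 : (c s t k : ℕ) → c ≥ 2 → s ≥ 2 → IsFloorLog c (s ∸ 1) k →
    (t ≤ k ⊎ t ≥ c ^ s ∸ k) →
    (χ : EdgeColouring c s t) → ¬ IsIdentityColouring χ
-- s = 0 is excluded by s ≥ 2; for the vertex count suc s, the floor-log bound reads c ^ k ≤ s.
lemma4 c (suc s) t k c≥2 _ (c^k≤s , _) t-small-or-large χ =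
  [ (λ t≤k → c^t<s⇒¬identity χ (s≤s (≤-trans (^-monoʳ-≤ c t≤k) c^k≤s)))
  , c^s∸k≤t⇒¬identity χ {k} (s≤s c^k≤s)
  ]′ t-small-or-large
  where
  instance
    c-nonZero : NonZero c
    c-nonZero = >-nonZero (<-≤-trans (s≤s z≤n) c≥2)
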